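{- Let $G=(V,E)$ be an undirected connected graph, $\mathfrak{G}^S$ a CFI-graph over $G$, and $\mu\in\mathrm{HF}(\widehat{E})$. Let $A=\sup_{\mathrm{CFI}}(\mu)$ and let $k$ be the number of connected components of the graph $(V,E\setminus A)$. Then $|\mathrm{Orb}_E(\mu)|\le 2^{k^2}\cdot|\mathrm{Orb}_{\mathfrak{G}^S}(\mu)|$.
   Context: CFI construction: $\widehat{E}=\{e_0,e_1\mid e\in E\}$; for $S\subseteq V$ the CFI-graph $\mathfrak{G}^S$ has vertex set $\widehat{E}$ together with vertices $v^X$ ($v\in V$, $X\subseteq E(v)$, $|X|$ even if $v\notin S$ and odd if $v\in S$), and edges $\{e_0,e_1\}$ ($e\in E$) and $\{v^X,e_i\}$ for $e\in E(v)$, $i=|X\cap\{e\}|$. Hereditarily finite sets: $\mathrm{HF}_0=\widehat{E}\cup\{\emptyset\}$, $\mathrm{HF}_{i+1}=\mathrm{HF}_i\cup2^{\mathrm{HF}_i}$, $\mathrm{HF}(\widehat{E})=\bigcup_i\mathrm{HF}_i$; permutations of $\widehat{E}$ act on $\mathrm{HF}(\widehat{E})$ by renaming atoms. For $F\subseteq E$, the edge flip $\rho_F$ swaps $e_0,e_1$ for each $e\in F$ and fixes all other atoms. $\mathrm{Orb}_E(\mu)=\{\rho_F(\mu)\mid F\subseteq E\}$. $\mathrm{Aut}(\mathfrak{G}^S)$ denotes the automorphisms of the graph $\mathfrak{G}^S$ mapping $\widehat{E}$ onto itself (acting on $\mathrm{HF}(\widehat{E})$ via their restriction to $\widehat{E}$),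 and $\mathrm{Orb}_{\mathfrak{G}^S}(\mu)=\{\alpha(\mu)\mid\alpha\in\mathrm{Aut}(\mathfrak{G}^S)\}$. A CFI-support of $\mu$ is a set $B\subseteq E$ such that $\rho_F(\mu)=\mu$ for all $F\subseteq E$ with $F\cap B=\emptyset$; the intersection of two CFI-supports is again one, so there is a unique minimal CFI-support, denoted $\sup_{\mathrm{CFI}}(\mu)$. -}

module Defs where

open import Data.Nat using (ℕ; zero; suc; _≤_; _%_; _*_; _^_)
open import Data.Bool using (Bool; true; false; _∧_; _∨_; not; if_then_else_; T; _xor_)
open import Data.Fin using (Fin; _≟_)
open import Data.Fin.Subset using (Subset; ∁; ∣_∣)
open import Data.Vec using (Vec; []; _∷_; lookup)
open import Data.List using (List; []; _∷_; length; map)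
open import Data.List.Relation.Unary.All using (All)
open import Data.Product using (Σ; _×_; _,_; proj₁; proj₂; ∃)
open import Data.Sum using (_⊎_; inj₁; inj₂)
open import Data.Empty using (⊥)
open import Data.Unit using (⊤)
open import Relation.Nullary using (¬_)
open import Relation.Nullary.Decidable using (⌊_⌋)
open import Relation.Binary.PropositionalEquality using (_≡_; _≢_)
open import Function.Bundles using (_↔_; _⇔_; Inverse)

record Graph (n m : ℕ) : Set where
  field
    ends   : Fin m → Fin n × Fin n
    noLoop : ∀ e → proj₁ (ends e) ≢ proj₂ (ends e)
    simple : ∀ e e' →
             (ends e ≡ ends e' ⊎ (proj₁ (ends e) ≡ proj₂ (ends e') × proj₂ (ends e) ≡ proj₁ (ends e'))) →
             e ≡ e'
open Graph public

incident : ∀ {n m} → Graph n m → Fin n → Fin m → Bool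
incident G v e = ⌊ v ≟ proj₁ (ends G e) ⌋ ∨ ⌊ v ≟ proj₂ (ends G e) ⌋

data Path {n m} (G : Graph n m) (F : Subset m) : Fin n → Fin n → Set where
  here : ∀ {u} → Path G F u u
  step : ∀ {u w v} (e : Fin m) → lookup F e ≡ true →
         (ends G e ≡ (u , w) ⊎ ends G e ≡ (w , u)) →
         Path G F w v → Path G F u v

allEdges : (m : ℕ) → Subset m
allEdges zero = []
allEdges (suc m) = true ∷ allEdges m

Connected : ∀ {n m} → Graph n m → Set
Connected {m = m} G = ∀ u v → Path G (allEdges m) u v

NumComponents : ∀ {n m} → Graph n m → Subset m → ℕ → Set
NumComponents {n} G F k =
  Σ (Fin n → Fin k) λ c →
    (∀ (i : Fin k) → ∃ λ v → c v ≡ i) ×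
    (∀ u v → (c u ≡ c v) ⇔ Path G F u v)

-- Atoms  Ê = { e_i | e ∈ E, i ∈ {0,1} },  e_i encoded as (e , i) with 0 = false.

Atom : ℕ → Set
Atom m = Fin m × Bool

-- Hereditarily finite sets over atoms (a set is given by a finite list of
-- members; equality is extensional, see _≈_).
data HF (X : Set) : Set where
  atom : X → HF X
  set  : List (HF X) → HF X

module _ {X : Set} where
  mutual
    _≈_ : HF X → HF X → Set
    atom a ≈ atom b = a ≡ b
    atom _ ≈ set _  = ⊥
    set _  ≈ atom _ = ⊥
    set xs ≈ set ys = (xs ⊑ ys) × (ys ⊑ xs)

    _⊑_ : List (HF X) → List (HF X) → Set
    [] ⊑ ys = ⊤
    (x ∷ xs) ⊑ ys = (x ∈≈ ys) × (xs ⊑ ys)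

    _∈≈_ : HF X → List (HF X) → Set
    x ∈≈ [] = ⊥
    x ∈≈ (y ∷ ys) = (x ≈ y) ⊎ (x ∈≈ ys)

-- renaming of atoms (action of a permutation of Ê)
rename : ∀ {X Y : Set} → (X → Y) → HF X → HF Y
renameList : ∀ {X Y : Set} → (X → Y) → List (HF X) → List (HF Y)
rename f (atom a) = atom (f a)
rename f (set xs) = set (renameList f xs)
renameList f [] = []
renameList f (x ∷ xs) = rename f x ∷ renameList f xs

flipAtom : ∀ {m} → Subset m → Atom m → Atom m
flipAtom F (e , i) = (e , i xor lookup F e)

ρ : ∀ {m} → Subset m → HF (Atom m) → HF (Atom m)
ρ F = rename (flipAtom F)

Disjoint : ∀ {m} → Subset m → Subset m → Set
Disjoint F B = ∀ e → lookup F e ≡ true → lookup B e ≡ false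

IsCFISupport : ∀ {m} → HF (Atom m) → Subset m → Set
IsCFISupport {m} μ B = ∀ (F : Subset m) → Disjoint F B → ρ F μ ≈ μ

IsMinCFISupport : ∀ {m} → HF (Atom m) → Subset m → Set
IsMinCFISupport {m} μ A =
  IsCFISupport μ A ×
  (∀ (B : Subset m) → IsCFISupport μ B → ∀ e → lookup A e ≡ true → lookup B e ≡ true)

subsetᵇ : ∀ {m} → Subset m → Subset m → Bool
subsetᵇ [] [] = true
subsetᵇ (x ∷ xs) (y ∷ ys) = (not x ∨ y) ∧ subsetᵇ xs ys

incidentSet : ∀ {n m} → Graph n m → Fin n → Subset m
incidentSet {m = m} G v = Data.Vec.tabulate (incident G v)
  where import Data.Vec

validGadget : ∀ {n m} → Graph n m → Subset n → Fin n → Subset m → Bool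
validGadget G S v X =
  subsetᵇ X (incidentSet G v) ∧
  ⌊ ∣ X ∣ % 2 Data.Nat.≟ (if lookup S v then 1 else 0) ⌋
  where import Data.Nat

GadgetVertex : ∀ {n m} → Graph n m → Subset n → Set
GadgetVertex {n} {m} G S = Σ (Fin n × Subset m) λ p → T (validGadget G S (proj₁ p) (proj₂ p))

CFIVertex : ∀ {n m} → Graph n m → Subset n → Set
CFIVertex {m = m} G S = Atom m ⊎ GadgetVertex G S

CFIAdj : ∀ {n m} (G : Graph n m) (S : Subset n) → CFIVertex G S → CFIVertex G S → Set
CFIAdj G S (inj₁ (e , i)) (inj₁ (e' , j)) = (e ≡ e') × (i ≢ j)
CFIAdj G S (inj₂ ((v , X) , _)) (inj₁ (e , i)) = (incident G v e ≡ true) × (i ≡ lookup X e)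
CFIAdj G S (inj₁ (e , i)) (inj₂ ((v , X) , _)) = (incident G v e ≡ true) × (i ≡ lookup X e)
CFIAdj G S (inj₂ _) (inj₂ _) = ⊥

IsCFIAut : ∀ {n m} (G : Graph n m) (S : Subset n) → (CFIVertex G S ↔ CFIVertex G S) → Set
IsCFIAut G S α = ∀ x y → CFIAdj G S x y ⇔ CFIAdj G S (Inverse.to α x) (Inverse.to α y)

-- π : Ê → Ê is the restriction to Ê of an automorphism of 𝔊^S mapping Ê onto Ê
-- (an injective self-map of the finite set Ê is onto)
IsAutRestriction : ∀ {n m} (G : Graph n m) (S : Subset n) → (Atom m → Atom m) → Set
IsAutRestriction G S π =
  Σ (CFIVertex G S ↔ CFIVertex G S) λ α →
    IsCFIAut G S α × (∀ a → Inverse.to α (inj₁ a) ≡ inj₁ (π a))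

InOrbE : ∀ {m} → HF (Atom m) → HF (Atom m) → Set
InOrbE {m} μ x = Σ (Subset m) λ F → x ≈ ρ F μ

InOrbCFI : ∀ {n m} (G : Graph n m) (S : Subset n) → HF (Atom m) → HF (Atom m) → Set
InOrbCFI {m = m} G S μ x = Σ (Atom m → Atom m) λ π → IsAutRestriction G S π × (x ≈ rename π μ)

data Distinct≈ {X : Set} : List (HF X) → Set where
  []  : Distinct≈ []
  _∷_ : ∀ {x xs} → ¬ (x ∈≈ xs) → Distinct≈ xs → Distinct≈ (x ∷ xs)

HasCard : ∀ {X : Set} → (HF X → Set) → ℕ → Set
HasCard {X} P c =
  Σ (List (HF X)) λ xs →
    (length xs ≡ c) × Distinct≈ xs × All P xs × (∀ x → P x → x ∈≈ xs)

{-# OPTIONS --safe #-}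
-- Flips agreeing on A act alike on μ, since A is
-- a support. The edge class of a flip F records, for each component, the parity of the number of
-- odd-degree vertices of F ∩ A lying in it. If F and F′ have the same class, the odd vertices of
-- (F ⊕ F′) ∩ A come in even numbers per component, so joining each of them to the root of its
-- component by a path avoiding A turns (F ⊕ F′) ∩ A into an even edge set D with the same edges in A.
-- Flipping the edges of an even set D (and every gadget v^X to v^(X ⊕ (D ∩ E(v)))) is an automorphism
-- of the CFI graph, so ρ_F μ = ρ_F′ (ρ_D μ) with ρ_D μ in the CFI orbit. Hence each of the at most
-- 2^k classes contributes at most |Orb_𝔊(μ)| elements to Orb_E(μ), and 2^k ≤ 2^(k²).
module Submission where

open import Defs
open import Data.Nat using (ℕ; _≤_; _*_; _^_)
open import Data.Fin.Subset using (Subset; ∁)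

open import Algebra.Bundles using (CommutativeRing)
open import Data.Bool using (Bool; true; false; not; _∧_; _∨_; _xor_; T; if_then_else_)
open import Data.Bool.Properties
  using (∧-assoc; xor-assoc; xor-comm; xor-same; xor-identityʳ; ∧-identityʳ; ∧-zeroʳ; ∨-zeroʳ;
         ∧-distribˡ-xor; ∧-distribʳ-xor; T-irrelevant; xor-∧-commutativeRing)
open import Data.Bool.Solver using (module xor-∧-Solver)
open import Algebra.Properties.Semiring.Sum (CommutativeRing.semiring xor-∧-commutativeRing)
  using (sum; sum-syntax; sum-cong-≗; sum-replicate-zero; sum-remove; ∑-distrib-+; ∑-comm;
         *-distribˡ-sum; *-distribʳ-sum)
open import Data.Empty using (⊥-elim)
open import Data.Fin using (Fin; zero; suc; _≟_; punchIn; combine; funToFin; finToFun)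
open import Data.Fin.Properties
  using (any?; combine-injective; injective⇒≤; finToFun-funToFin; punchInᵢ≢i; 2↔Bool)
open import Data.Fin.Subset using (_∩_; ∣_∣)
open import Data.List using (List; []; _∷_; length)
import Data.List as List
open import Data.List.Membership.Propositional.Properties using (∈-lookup)
import Data.List.Relation.Unary.All as All
open import Data.Nat using (zero; suc; z≤n; _+_; _%_)
import Data.Nat as ℕ
open import Data.Nat.DivMod using (%-distribˡ-+)
open import Data.Nat.Properties using (≤-trans; m≤m*n; *-monoˡ-≤; ^-monoʳ-≤)
open import Data.Product using (Σ; ∃; _×_; _,_; proj₁; proj₂; map₂)
open import Data.Sum using (_⊎_; inj₁; inj₂)
open import Data.Unit using (tt)
open import Data.Vec using ([]; _∷_; lookup; zipWith; tabulate)
open import Data.Vec.Properties using (lookup-zipWith; lookup∘tabulate; lookup-map)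
open import Function using (_∘_)
open import Function.Bundles using (Inverse; Equivalence; _↔_; _⇔_; mk↔ₛ′; mk⇔)
open import Level using (0ℓ)
open import Relation.Binary.Bundles using (Setoid)
import Relation.Binary.Reasoning.Setoid
open import Relation.Binary.PropositionalEquality
  using (_≡_; _≢_; refl; sym; trans; cong; cong₂; subst; module ≡-Reasoning)
open import Relation.Nullary using (¬_; yes; no)
open import Relation.Nullary.Decidable using (Dec; ⌊_⌋; isYes≗does; dec-true; dec-false)

-- Hereditarily finite sets up to extensional equality

module _ {X : Set} where

  ⊑-weaken : ∀ {y : HF X} (xs : List (HF X)) {ys} → xs ⊑ ys → xs ⊑ (y ∷ ys)
  ⊑-weaken [] _ = tt
  ⊑-weaken (x ∷ xs) (x∈ys , xs⊑ys) = inj₂ x∈ys , ⊑-weaken xs xs⊑ys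

  mutual
    ≈-refl : (x : HF X) → x ≈ x
    ≈-refl (atom a) = refl
    ≈-refl (set xs) = ⊑-refl xs , ⊑-refl xs

    ⊑-refl : (xs : List (HF X)) → xs ⊑ xs
    ⊑-refl [] = tt
    ⊑-refl (x ∷ xs) = inj₁ (≈-refl x) , ⊑-weaken xs (⊑-refl xs)

  ≈-sym : (x y : HF X) → x ≈ y → y ≈ x
  ≈-sym (atom a) (atom b) a≡b = sym a≡b
  ≈-sym (set xs) (set ys) (xs⊑ys , ys⊑xs) = ys⊑xs , xs⊑ys

  mutual
    ≈-trans : (x y z : HF X) → x ≈ y → y ≈ z → x ≈ z
    ≈-trans (atom a) (atom b) (atom c) a≡b b≡c = trans a≡b b≡c
    ≈-trans (set xs) (set ys) (set zs) (xs⊑ys , ys⊑xs) (ys⊑zs , zs⊑ys) =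
      ⊑-trans xs ys zs xs⊑ys ys⊑zs , ⊑-trans zs ys xs zs⊑ys ys⊑xs

    ⊑-trans : (xs ys zs : List (HF X)) → xs ⊑ ys → ys ⊑ zs → xs ⊑ zs
    ⊑-trans [] ys zs _ _ = tt
    ⊑-trans (x ∷ xs) ys zs (x∈ys , xs⊑ys) ys⊑zs =
      ∈≈-⊑ x ys zs x∈ys ys⊑zs , ⊑-trans xs ys zs xs⊑ys ys⊑zs

    ∈≈-⊑ : (x : HF X) (ys zs : List (HF X)) → x ∈≈ ys → ys ⊑ zs → x ∈≈ zs
    ∈≈-⊑ x (y ∷ ys) zs (inj₁ x≈y) (y∈zs , _) = ∈≈-respˡ x y zs x≈y y∈zs
    ∈≈-⊑ x (y ∷ ys) zs (inj₂ x∈ys) (_ , ys⊑zs) = ∈≈-⊑ x ys zs x∈ys ys⊑zs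

    ∈≈-respˡ : (x y : HF X) (zs : List (HF X)) → x ≈ y → y ∈≈ zs → x ∈≈ zs
    ∈≈-respˡ x y (z ∷ zs) x≈y (inj₁ y≈z) = inj₁ (≈-trans x y z x≈y y≈z)
    ∈≈-respˡ x y (z ∷ zs) x≈y (inj₂ y∈zs) = inj₂ (∈≈-respˡ x y zs x≈y y∈zs)

  ≈-setoid : Setoid 0ℓ 0ℓ
  ≈-setoid = record
    { Carrier = HF X
    ; _≈_ = _≈_
    ; isEquivalence = record
      { refl = λ {x} → ≈-refl x
      ; sym = λ {x} {y} → ≈-sym x y
      ; trans = λ {x} {y} {z} → ≈-trans x y z
      }
    }

  module ≈-Reasoning = Relation.Binary.Reasoning.Setoid ≈-setoid

  lookup-∈≈ : (xs : List (HF X)) (i : Fin (length xs)) → List.lookup xs i ∈≈ xs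
  lookup-∈≈ (x ∷ xs) zero = inj₁ (≈-refl x)
  lookup-∈≈ (x ∷ xs) (suc i) = inj₂ (lookup-∈≈ xs i)

  ∈≈⇒lookup : ∀ {x} (ys : List (HF X)) → x ∈≈ ys → Σ (Fin (length ys)) λ j → x ≈ List.lookup ys j
  ∈≈⇒lookup (y ∷ ys) (inj₁ x≈y) = zero , x≈y
  ∈≈⇒lookup (y ∷ ys) (inj₂ x∈ys) with ∈≈⇒lookup ys x∈ys
  ... | j , x≈yⱼ = suc j , x≈yⱼ

  Distinct≈⇒lookup-injective : ∀ {xs : List (HF X)} → Distinct≈ xs → ∀ i j →
                               List.lookup xs i ≈ List.lookup xs j → i ≡ j
  Distinct≈⇒lookup-injective (_ ∷ _) zero zero _ = refl
  Distinct≈⇒lookup-injective {x ∷ xs} (x∉xs ∷ _) zero (suc j) x≈xⱼ =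
    ⊥-elim (x∉xs (∈≈-respˡ x _ xs x≈xⱼ (lookup-∈≈ xs j)))
  Distinct≈⇒lookup-injective {x ∷ xs} (x∉xs ∷ _) (suc i) zero xᵢ≈x =
    ⊥-elim (x∉xs (∈≈-respˡ x _ xs (≈-sym _ x xᵢ≈x) (lookup-∈≈ xs i)))
  Distinct≈⇒lookup-injective (_ ∷ distinct) (suc i) (suc j) xᵢ≈xⱼ =
    cong suc (Distinct≈⇒lookup-injective distinct i j xᵢ≈xⱼ)

module _ {X Y : Set} (f : X → Y) where

  mutual
    rename-≈ : (x y : HF X) → x ≈ y → rename f x ≈ rename f y
    rename-≈ (atom a) (atom b) a≡b = cong f a≡b
    rename-≈ (set xs) (set ys) (xs⊑ys , ys⊑xs) = renameList-⊑ xs ys xs⊑ys , renameList-⊑ ys xs ys⊑xs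

    renameList-⊑ : (xs ys : List (HF X)) → xs ⊑ ys → renameList f xs ⊑ renameList f ys
    renameList-⊑ [] ys _ = tt
    renameList-⊑ (x ∷ xs) ys (x∈ys , xs⊑ys) = renameList-∈≈ x ys x∈ys , renameList-⊑ xs ys xs⊑ys

    renameList-∈≈ : (x : HF X) (ys : List (HF X)) → x ∈≈ ys → rename f x ∈≈ renameList f ys
    renameList-∈≈ x (y ∷ ys) (inj₁ x≈y) = inj₁ (rename-≈ x y x≈y)
    renameList-∈≈ x (y ∷ ys) (inj₂ x∈ys) = inj₂ (renameList-∈≈ x ys x∈ys)

module _ {X Y : Set} {f g : X → Y} (f≗g : ∀ a → f a ≡ g a) where

  mutual
    rename-cong : (x : HF X) → rename f x ≡ rename g x
    rename-cong (atom a) = cong atom (f≗g a)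
    rename-cong (set xs) = cong set (renameList-cong xs)

    renameList-cong : (xs : List (HF X)) → renameList f xs ≡ renameList g xs
    renameList-cong [] = refl
    renameList-cong (x ∷ xs) = cong₂ _∷_ (rename-cong x) (renameList-cong xs)

module _ {X Y Z : Set} (f : Y → Z) (g : X → Y) where

  mutual
    rename-∘ : (x : HF X) → rename f (rename g x) ≡ rename (λ a → f (g a)) x
    rename-∘ (atom a) = refl
    rename-∘ (set xs) = cong set (renameList-∘ xs)

    renameList-∘ : (xs : List (HF X)) → renameList f (renameList g xs) ≡ renameList (λ a → f (g a)) xs
    renameList-∘ [] = refl
    renameList-∘ (x ∷ xs) = cong₂ _∷_ (rename-∘ x) (renameList-∘ xs)

-- Edge flips

xor-cancelʳ : ∀ a b → (a xor b) xor b ≡ a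
xor-cancelʳ a b = trans (xor-assoc a b b) (trans (cong (a xor_) (xor-same b)) (xor-identityʳ a))

xorʳ-≡⇔ : ∀ d {a b} → (a ≡ b) ⇔ (a xor d ≡ b xor d)
xorʳ-≡⇔ d {a} {b} = mk⇔ (cong (_xor d))
  (λ eq → trans (sym (xor-cancelʳ a d)) (trans (cong (_xor d) eq) (xor-cancelʳ b d)))

infixl 6 _⊕_

_⊕_ : ∀ {m} → Subset m → Subset m → Subset m
_⊕_ = zipWith _xor_

lookup-⊕ : ∀ {m} (F F′ : Subset m) e → lookup (F ⊕ F′) e ≡ lookup F e xor lookup F′ e
lookup-⊕ F F′ e = lookup-zipWith _xor_ e F F′

⊕-cancelʳ : ∀ {m} (F F′ : Subset m) → F ⊕ F′ ⊕ F′ ≡ F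
⊕-cancelʳ [] [] = refl
⊕-cancelʳ (a ∷ F) (b ∷ F′) = cong₂ _∷_ (xor-cancelʳ a b) (⊕-cancelʳ F F′)

module _ {m : ℕ} where

  ρ-∘ : ∀ (F F′ : Subset m) x → ρ F (ρ F′ x) ≡ ρ (F′ ⊕ F) x
  ρ-∘ F F′ x = trans (rename-∘ (flipAtom F) (flipAtom F′) x) (rename-cong flip-∘ x)
    where
    flip-∘ : ∀ a → flipAtom F (flipAtom F′ a) ≡ flipAtom (F′ ⊕ F) a
    flip-∘ (e , i) = cong (e ,_) (trans (xor-assoc i _ _) (cong (i xor_) (sym (lookup-⊕ F′ F e))))

  ⊕-disjoint : ∀ {A F F′ : Subset m} → (∀ e → lookup A e ≡ true → lookup F e ≡ lookup F′ e) →
               Disjoint (F ⊕ F′) A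
  ⊕-disjoint {A} {F} {F′} agree e e∈F⊕F′ with lookup A e in e∈A
  ... | false = refl
  ... | true with () ← trans (sym e∈F⊕F′) (trans (lookup-⊕ F F′ e)
                         (trans (cong (_xor lookup F′ e) (agree e e∈A)) (xor-same (lookup F′ e))))

  ρ-agreeingOn-support : ∀ {μ A} → IsCFISupport μ A → ∀ (F F′ : Subset m) →
                         (∀ e → lookup A e ≡ true → lookup F e ≡ lookup F′ e) → ρ F μ ≈ ρ F′ μ
  ρ-agreeingOn-support {μ} {A} supp F F′ agree = begin
    ρ F μ                   ≡⟨ cong (λ F″ → ρ F″ μ) (⊕-cancelʳ F F′) ⟨
    ρ (F ⊕ F′ ⊕ F′) μ       ≡⟨ ρ-∘ F′ (F ⊕ F′) μ ⟨
    ρ F′ (ρ (F ⊕ F′) μ)     ≈⟨ rename-≈ (flipAtom F′) _ μ (supp (F ⊕ F′) (⊕-disjoint {A} {F} {F′} agree)) ⟩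
    ρ F′ μ                  ∎
    where open ≈-Reasoning

-- Sums over GF(2)

sum-false : ∀ {n} {f : Fin n → Bool} → (∀ i → f i ≡ false) → sum f ≡ false
sum-false {n} f≡false = trans (sum-cong-≗ f≡false) (sum-replicate-zero n)

sum-single : ∀ {n} {f : Fin n → Bool} i → (∀ j → j ≢ i → f j ≡ false) → sum f ≡ f i
sum-single {suc n} {f} i off = trans (sum-remove {i = i} f)
  (trans (cong (f i xor_) (sum-false (λ j → off (punchIn i j) (punchInᵢ≢i i j)))) (xor-identityʳ (f i)))

parity : ∀ {m} → Subset m → Bool
parity X = sum (lookup X)

parity-⊕ : ∀ {m} (X Y : Subset m) → parity (X ⊕ Y) ≡ parity X xor parity Y
parity-⊕ X Y = trans (sum-cong-≗ (lookup-⊕ X Y)) (∑-distrib-+ (lookup X) (lookup Y))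

∣∣%2≡parity : ∀ {m} (X : Subset m) → ∣ X ∣ % 2 ≡ (if parity X then 1 else 0)
∣∣%2≡parity [] = refl
∣∣%2≡parity (false ∷ X) = ∣∣%2≡parity X
∣∣%2≡parity (true ∷ X) =
  trans (%-distribˡ-+ 1 ∣ X ∣ 2) (trans (cong (λ r → (1 + r) % 2) (∣∣%2≡parity X)) (one-more (parity X)))
  where
  one-more : ∀ b → (1 + (if b then 1 else 0)) % 2 ≡ (if not b then 1 else 0)
  one-more false = refl
  one-more true = refl

∣⊕∣%2 : ∀ {m} (X Y : Subset m) → parity Y ≡ false → ∣ X ⊕ Y ∣ % 2 ≡ ∣ X ∣ % 2
∣⊕∣%2 X Y Y-even = trans (∣∣%2≡parity (X ⊕ Y))
  (trans (cong (λ b → if b then 1 else 0) (trans (parity-⊕ X Y)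
           (trans (cong (parity X xor_) Y-even) (xor-identityʳ (parity X)))))
         (sym (∣∣%2≡parity X)))

-- Odd-degree vertices, paths and T-joins

⌊⌋-true : ∀ {A : Set} (a? : Dec A) → A → ⌊ a? ⌋ ≡ true
⌊⌋-true a? a = trans (isYes≗does a?) (dec-true a? a)

⌊⌋-false : ∀ {A : Set} (a? : Dec A) → ¬ A → ⌊ a? ⌋ ≡ false
⌊⌋-false a? ¬a = trans (isYes≗does a?) (dec-false a? ¬a)

module _ {n m} (G : Graph n m) where

  oddDegree : (Fin m → Bool) → Fin n → Bool
  oddDegree H v = ∑[ e < m ] (H e ∧ incident G v e)

  oddDegree-cong : ∀ {H H′} → (∀ e → H e ≡ H′ e) → ∀ v → oddDegree H v ≡ oddDegree H′ v
  oddDegree-cong H≗H′ v = sum-cong-≗ (λ e → cong (_∧ incident G v e) (H≗H′ e))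

  oddDegree-xor : ∀ H H′ v → oddDegree (λ e → H e xor H′ e) v ≡ oddDegree H v xor oddDegree H′ v
  oddDegree-xor H H′ v =
    trans (sum-cong-≗ (λ e → ∧-distribʳ-xor (incident G v e) (H e) (H′ e)))
          (∑-distrib-+ (λ e → H e ∧ incident G v e) (λ e → H′ e ∧ incident G v e))

  oddDegree-⊕ : ∀ (X Y : Subset m) v →
                oddDegree (lookup (X ⊕ Y)) v ≡ oddDegree (lookup X) v xor oddDegree (lookup Y) v
  oddDegree-⊕ X Y v = trans (oddDegree-cong (lookup-⊕ X Y) v) (oddDegree-xor (lookup X) (lookup Y) v)

  oddDegree-∑ : ∀ {k} (T : Fin k → Bool) (P : Fin k → Fin m → Bool) w →
                oddDegree (λ e → ∑[ v < k ] (T v ∧ P v e)) w ≡ ∑[ v < k ] (T v ∧ oddDegree (P v) w)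
  oddDegree-∑ {k} T P w = begin
    ∑[ e < m ] (∑[ v < k ] (T v ∧ P v e) ∧ incident G w e)
      ≡⟨ sum-cong-≗ (λ e → *-distribʳ-sum (incident G w e) (λ v → T v ∧ P v e)) ⟩
    ∑[ e < m ] ∑[ v < k ] ((T v ∧ P v e) ∧ incident G w e)
      ≡⟨ ∑-comm (λ e v → (T v ∧ P v e) ∧ incident G w e) ⟩
    ∑[ v < k ] ∑[ e < m ] ((T v ∧ P v e) ∧ incident G w e)
      ≡⟨ sum-cong-≗ (λ v → sum-cong-≗ (λ e → ∧-assoc (T v) (P v e) (incident G w e))) ⟩
    ∑[ v < k ] ∑[ e < m ] (T v ∧ (P v e ∧ incident G w e))
      ≡⟨ sum-cong-≗ (λ v → *-distribˡ-sum (T v) (λ e → P v e ∧ incident G w e)) ⟨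
    ∑[ v < k ] (T v ∧ oddDegree (P v) w) ∎
    where open ≡-Reasoning

  parity-∩-incidentSet : ∀ (D : Subset m) v → parity (D ∩ incidentSet G v) ≡ oddDegree (lookup D) v
  parity-∩-incidentSet D v = sum-cong-≗ λ e →
    trans (lookup-zipWith _∧_ e D _) (cong (lookup D e ∧_) (lookup∘tabulate (incident G v) e))

  incident-ends : ∀ {e s t} w → ends G e ≡ (s , t) → incident G w e ≡ ⌊ w ≟ s ⌋ xor ⌊ w ≟ t ⌋
  incident-ends {e} w refl with w ≟ proj₁ (ends G e) | w ≟ proj₂ (ends G e)
  ... | yes w≡s | yes w≡t = ⊥-elim (noLoop G e (trans (sym w≡s) w≡t))
  ... | yes _   | no _    = refl
  ... | no _    | yes _   = refl
  ... | no _    | no _    = refl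

  oddDegree-edge : ∀ e v → oddDegree (λ e′ → ⌊ e′ ≟ e ⌋) v ≡ incident G v e
  oddDegree-edge e v =
    trans (sum-single e (λ e′ e′≢e → cong (_∧ incident G v e′) (⌊⌋-false (e′ ≟ e) e′≢e)))
          (cong (_∧ incident G v e) (⌊⌋-true (e ≟ e) refl))

  pathEdges : ∀ {F u v} → Path G F u v → Fin m → Bool
  pathEdges here _ = false
  pathEdges (step e′ _ _ p) e = ⌊ e ≟ e′ ⌋ xor pathEdges p e

  pathEdges-⊆ : ∀ {F u v} (p : Path G F u v) e → lookup F e ≡ false → pathEdges p e ≡ false
  pathEdges-⊆ here e _ = refl
  pathEdges-⊆ (step e′ e′∈F _ p) e e∉F with e ≟ e′
  ... | yes refl with () ← trans (sym e∉F) e′∈F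
  ... | no _ = pathEdges-⊆ p e e∉F

  oddDegree-pathEdges : ∀ {F u v} (p : Path G F u v) w →
                        oddDegree (pathEdges p) w ≡ ⌊ w ≟ u ⌋ xor ⌊ w ≟ v ⌋
  oddDegree-pathEdges {u = u} here w = trans (sum-false {m} (λ _ → refl)) (sym (xor-same ⌊ w ≟ u ⌋))
  oddDegree-pathEdges {u = u} {v} (step {w = u′} e e∈F e-ends p) w = begin
    oddDegree (pathEdges (step e e∈F e-ends p)) w
      ≡⟨ oddDegree-xor (λ e′ → ⌊ e′ ≟ e ⌋) (pathEdges p) w ⟩
    oddDegree (λ e′ → ⌊ e′ ≟ e ⌋) w xor oddDegree (pathEdges p) w
      ≡⟨ cong₂ _xor_ (oddDegree-edge e w) (oddDegree-pathEdges p w) ⟩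
    incident G w e xor (⌊ w ≟ u′ ⌋ xor ⌊ w ≟ v ⌋)
      ≡⟨ cong (_xor _) (incident-step e-ends) ⟩
    (⌊ w ≟ u ⌋ xor ⌊ w ≟ u′ ⌋) xor (⌊ w ≟ u′ ⌋ xor ⌊ w ≟ v ⌋)
      ≡⟨ xor-telescope ⌊ w ≟ u ⌋ ⌊ w ≟ u′ ⌋ ⌊ w ≟ v ⌋ ⟩
    ⌊ w ≟ u ⌋ xor ⌊ w ≟ v ⌋ ∎
    where
    open ≡-Reasoning
    open xor-∧-Solver
    xor-telescope : ∀ a b c → (a xor b) xor (b xor c) ≡ a xor c
    xor-telescope = solve 3 (λ a b c → (a :+ b) :+ (b :+ c) := a :+ c) refl
    incident-step : ends G e ≡ (u , u′) ⊎ ends G e ≡ (u′ , u) → incident G w e ≡ ⌊ w ≟ u ⌋ xor ⌊ w ≟ u′ ⌋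
    incident-step (inj₁ e-ends) = incident-ends w e-ends
    incident-step (inj₂ e-ends) = trans (incident-ends w e-ends) (xor-comm ⌊ w ≟ u′ ⌋ ⌊ w ≟ u ⌋)

module _ {n k} (c : Fin n → Fin k) where

  componentParity : (Fin n → Bool) → Fin k → Bool
  componentParity T i = ∑[ v < n ] (⌊ c v ≟ i ⌋ ∧ T v)

  componentParity-xor : ∀ {T T₁ T₂} → (∀ v → T v ≡ T₁ v xor T₂ v) → ∀ i →
                        componentParity T i ≡ componentParity T₁ i xor componentParity T₂ i
  componentParity-xor {T} {T₁} {T₂} T≗T₁⊕T₂ i = trans
    (sum-cong-≗ λ v → trans (cong (⌊ c v ≟ i ⌋ ∧_) (T≗T₁⊕T₂ v))
                            (∧-distribˡ-xor ⌊ c v ≟ i ⌋ (T₁ v) (T₂ v)))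
    (∑-distrib-+ (λ v → ⌊ c v ≟ i ⌋ ∧ T₁ v) (λ v → ⌊ c v ≟ i ⌋ ∧ T₂ v))

module _ {n m k} (G : Graph n m) (F : Subset m) (c : Fin n → Fin k)
         (c-surjective : ∀ i → ∃ λ v → c v ≡ i) (c-connects : ∀ u v → (c u ≡ c v) ⇔ Path G F u v) where

  private
    root : Fin k → Fin n
    root i = proj₁ (c-surjective i)

    c-root : ∀ i → c (root i) ≡ i
    c-root i = proj₂ (c-surjective i)

    toRoot : ∀ v → Path G F v (root (c v))
    toRoot v = Equivalence.to (c-connects v (root (c v))) (sym (c-root (c v)))

    ≟-root : ∀ v w → ⌊ w ≟ root (c v) ⌋ ≡ ⌊ c v ≟ c w ⌋ ∧ ⌊ w ≟ root (c w) ⌋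
    ≟-root v w with c v ≟ c w
    ... | yes cv≡cw = cong (λ i → ⌊ w ≟ root i ⌋) cv≡cw
    ... | no cv≢cw =
      ⌊⌋-false (w ≟ root (c v)) λ w≡root → cv≢cw (sym (trans (cong c w≡root) (c-root (c v))))

  T-join : (Fin n → Bool) → Fin m → Bool
  T-join T e = ∑[ v < n ] (T v ∧ pathEdges G (toRoot v) e)

  T-join-⊆ : ∀ T e → lookup F e ≡ false → T-join T e ≡ false
  T-join-⊆ T e e∉F =
    sum-false λ v → trans (cong (T v ∧_) (pathEdges-⊆ G (toRoot v) e e∉F)) (∧-zeroʳ (T v))

  oddDegree-T-join : ∀ T → (∀ i → componentParity c T i ≡ false) →
                     ∀ w → oddDegree G (T-join T) w ≡ T w
  oddDegree-T-join T balanced w = begin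
    oddDegree G (T-join T) w
      ≡⟨ oddDegree-∑ G T (λ v → pathEdges G (toRoot v)) w ⟩
    ∑[ v < n ] (T v ∧ oddDegree G (pathEdges G (toRoot v)) w)
      ≡⟨ sum-cong-≗ (λ v → cong (T v ∧_) (oddDegree-pathEdges G (toRoot v) w)) ⟩
    ∑[ v < n ] (T v ∧ (⌊ w ≟ v ⌋ xor ⌊ w ≟ root (c v) ⌋))
      ≡⟨ sum-cong-≗ (λ v → ∧-distribˡ-xor (T v) ⌊ w ≟ v ⌋ ⌊ w ≟ root (c v) ⌋) ⟩
    ∑[ v < n ] ((T v ∧ ⌊ w ≟ v ⌋) xor (T v ∧ ⌊ w ≟ root (c v) ⌋))
      ≡⟨ ∑-distrib-+ (λ v → T v ∧ ⌊ w ≟ v ⌋) (λ v → T v ∧ ⌊ w ≟ root (c v) ⌋) ⟩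
    ∑[ v < n ] (T v ∧ ⌊ w ≟ v ⌋) xor ∑[ v < n ] (T v ∧ ⌊ w ≟ root (c v) ⌋)
      ≡⟨ cong₂ _xor_ at-w at-root ⟩
    T w xor false
      ≡⟨ xor-identityʳ (T w) ⟩
    T w ∎
    where
    open ≡-Reasoning
    open xor-∧-Solver

    at-w : ∑[ v < n ] (T v ∧ ⌊ w ≟ v ⌋) ≡ T w
    at-w = trans (sum-single w λ v v≢w →
                   trans (cong (T v ∧_) (⌊⌋-false (w ≟ v) (v≢w ∘ sym))) (∧-zeroʳ (T v)))
                 (trans (cong (T w ∧_) (⌊⌋-true (w ≟ w) refl)) (∧-identityʳ (T w)))

    ∧-rearrange : ∀ t s r → t ∧ (s ∧ r) ≡ (s ∧ t) ∧ r
    ∧-rearrange = solve 3 (λ t s r → t :* (s :* r) := (s :* t) :* r) refl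

    -- w ends the path from v iff it is the root of v's component, and T is even on components.
    at-root : ∑[ v < n ] (T v ∧ ⌊ w ≟ root (c v) ⌋) ≡ false
    at-root = begin
      ∑[ v < n ] (T v ∧ ⌊ w ≟ root (c v) ⌋)
        ≡⟨ sum-cong-≗ (λ v → cong (T v ∧_) (≟-root v w)) ⟩
      ∑[ v < n ] (T v ∧ (⌊ c v ≟ c w ⌋ ∧ ⌊ w ≟ root (c w) ⌋))
        ≡⟨ sum-cong-≗ (λ v → ∧-rearrange (T v) ⌊ c v ≟ c w ⌋ ⌊ w ≟ root (c w) ⌋) ⟩
      ∑[ v < n ] ((⌊ c v ≟ c w ⌋ ∧ T v) ∧ ⌊ w ≟ root (c w) ⌋)
        ≡⟨ *-distribʳ-sum ⌊ w ≟ root (c w) ⌋ (λ v → ⌊ c v ≟ c w ⌋ ∧ T v) ⟨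
      componentParity c T (c w) ∧ ⌊ w ≟ root (c w) ⌋
        ≡⟨ cong (_∧ ⌊ w ≟ root (c w) ⌋) (balanced (c w)) ⟩
      false ∎

-- Flipping an even edge set is a CFI automorphism

subsetᵇ-⊕∩ : ∀ {m} (X D Y : Subset m) → subsetᵇ (X ⊕ (D ∩ Y)) Y ≡ subsetᵇ X Y
subsetᵇ-⊕∩ [] [] [] = refl
subsetᵇ-⊕∩ (x ∷ X) (d ∷ D) (true ∷ Y) =
  cong₂ _∧_ (trans (∨-zeroʳ _) (sym (∨-zeroʳ (not x)))) (subsetᵇ-⊕∩ X D Y)
subsetᵇ-⊕∩ (x ∷ X) (d ∷ D) (false ∷ Y) =
  cong₂ _∧_ (cong (λ b → not b ∨ false) (trans (cong (x xor_) (∧-zeroʳ d)) (xor-identityʳ x)))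
            (subsetᵇ-⊕∩ X D Y)

module _ {n m} (G : Graph n m) (S : Subset n) (D : Subset m)
         (D-even : ∀ v → oddDegree G (lookup D) v ≡ false) where

  shiftGadget : Fin n → Subset m → Subset m
  shiftGadget v X = X ⊕ (D ∩ incidentSet G v)

  validGadget-shiftGadget : ∀ v X → validGadget G S v (shiftGadget v X) ≡ validGadget G S v X
  validGadget-shiftGadget v X = cong₂ _∧_ (subsetᵇ-⊕∩ X D (incidentSet G v))
    (cong (λ r → ⌊ r ℕ.≟ (if lookup S v then 1 else 0) ⌋)
          (∣⊕∣%2 X _ (trans (parity-∩-incidentSet G D v) (D-even v))))

  lookup-shiftGadget : ∀ v X e → incident G v e ≡ true →
                       lookup (shiftGadget v X) e ≡ lookup X e xor lookup D e
  lookup-shiftGadget v X e e∈Ev = trans (lookup-⊕ X _ e) (cong (lookup X e xor_)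
    (trans (lookup-zipWith _∧_ e D _)
           (trans (cong (lookup D e ∧_) (trans (lookup∘tabulate (incident G v) e) e∈Ev)) (∧-identityʳ _))))

  flipVertex : CFIVertex G S → CFIVertex G S
  flipVertex (inj₁ a) = inj₁ (flipAtom D a)
  flipVertex (inj₂ ((v , X) , valid)) =
    inj₂ ((v , shiftGadget v X) , subst T (sym (validGadget-shiftGadget v X)) valid)

  flipVertex-involutive : ∀ x → flipVertex (flipVertex x) ≡ x
  flipVertex-involutive (inj₁ (e , i)) = cong (λ b → inj₁ (e , b)) (xor-cancelʳ i (lookup D e))
  flipVertex-involutive (inj₂ ((v , X) , valid)) = gadget-≡ _ valid (⊕-cancelʳ X (D ∩ incidentSet G v))
    where
    gadget-≡ : ∀ {Y} (valid′ : T (validGadget G S v Y)) valid → Y ≡ X →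
               inj₂ ((v , Y) , valid′) ≡ inj₂ ((v , X) , valid)
    gadget-≡ valid′ valid refl = cong (λ t → inj₂ ((v , X) , t)) (T-irrelevant valid′ valid)

  gadgetAdjacency⇔ : ∀ v X e i →
                     (incident G v e ≡ true × i ≡ lookup X e) ⇔
                     (incident G v e ≡ true × i xor lookup D e ≡ lookup (shiftGadget v X) e)
  gadgetAdjacency⇔ v X e i = mk⇔
    (λ (e∈Ev , i≡x) → e∈Ev , trans (cong (_xor lookup D e) i≡x) (sym (lookup-shiftGadget v X e e∈Ev)))
    (λ (e∈Ev , eq) → e∈Ev ,
       Equivalence.from (xorʳ-≡⇔ (lookup D e)) (trans eq (lookup-shiftGadget v X e e∈Ev)))

  flipVertex-↔ : CFIVertex G S ↔ CFIVertex G S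
  flipVertex-↔ = mk↔ₛ′ flipVertex flipVertex flipVertex-involutive flipVertex-involutive

  flipVertex-isCFIAut : IsCFIAut G S flipVertex-↔
  flipVertex-isCFIAut (inj₁ (e , i)) (inj₁ (e′ , j)) = mk⇔
    (λ { (refl , i≢j) → refl , λ eq → i≢j (Equivalence.from (xorʳ-≡⇔ (lookup D e)) eq) })
    (λ { (refl , i≢j) → refl , λ eq → i≢j (Equivalence.to (xorʳ-≡⇔ (lookup D e)) eq) })
  flipVertex-isCFIAut (inj₂ ((v , X) , _)) (inj₁ (e , i)) = gadgetAdjacency⇔ v X e i
  flipVertex-isCFIAut (inj₁ (e , i)) (inj₂ ((v , X) , _)) = gadgetAdjacency⇔ v X e i
  flipVertex-isCFIAut (inj₂ _) (inj₂ _) = mk⇔ (λ ()) (λ ())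

  evenFlip-isAutRestriction : IsAutRestriction G S (flipAtom D)
  evenFlip-isAutRestriction = flipVertex-↔ , flipVertex-isCFIAut , λ _ → refl

-- Edge classes

⊕-∩-distribʳ : ∀ {m} (F F′ A : Subset m) → (F ⊕ F′) ∩ A ≡ (F ∩ A) ⊕ (F′ ∩ A)
⊕-∩-distribʳ [] [] [] = refl
⊕-∩-distribʳ (f ∷ F) (f′ ∷ F′) (a ∷ A) = cong₂ _∷_ (∧-distribʳ-xor a f f′) (⊕-∩-distribʳ F F′ A)

module _ {n m k} (G : Graph n m) (A : Subset m) (c : Fin n → Fin k) where

  edgeClass : Subset m → Fin k → Bool
  edgeClass F = componentParity c (oddDegree G (lookup (F ∩ A)))

  edgeClass-⊕ : ∀ F F′ i → edgeClass (F ⊕ F′) i ≡ edgeClass F i xor edgeClass F′ i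
  edgeClass-⊕ F F′ = componentParity-xor c λ v →
    trans (cong (λ H → oddDegree G (lookup H) v) (⊕-∩-distribʳ F F′ A)) (oddDegree-⊕ G (F ∩ A) (F′ ∩ A) v)

  EvenExtension : Subset m → Set
  EvenExtension H = Σ (Subset m) λ D → (∀ v → oddDegree G (lookup D) v ≡ false) ×
                                       (∀ e → lookup A e ≡ true → lookup D e ≡ lookup H e)

  ρ-correctedOn-support : ∀ {μ} → IsCFISupport μ A → ∀ F F′ D →
                          (∀ e → lookup A e ≡ true → lookup D e ≡ lookup (F ⊕ F′) e) → ρ F μ ≈ ρ F′ (ρ D μ)
  ρ-correctedOn-support {μ} supp F F′ D D-onA = begin
    ρ F μ            ≈⟨ ρ-agreeingOn-support {A = A} supp F (D ⊕ F′) agree ⟩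
    ρ (D ⊕ F′) μ     ≡⟨ ρ-∘ F′ D μ ⟨
    ρ F′ (ρ D μ)     ∎
    where
    open ≈-Reasoning
    agree : ∀ e → lookup A e ≡ true → lookup F e ≡ lookup (D ⊕ F′) e
    agree e e∈A = sym (trans (lookup-⊕ D F′ e)
      (trans (cong (_xor lookup F′ e) (trans (D-onA e e∈A) (lookup-⊕ F F′ e)))
             (xor-cancelʳ (lookup F e) (lookup F′ e))))

  sameEdgeClass⇒⊕-balanced : ∀ F F′ → (∀ i → edgeClass F i ≡ edgeClass F′ i) →
                              ∀ i → edgeClass (F ⊕ F′) i ≡ false
  sameEdgeClass⇒⊕-balanced F F′ same i =
    trans (edgeClass-⊕ F F′ i) (trans (cong (_xor edgeClass F′ i) (same i)) (xor-same (edgeClass F′ i)))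

  module _ (c-surjective : ∀ i → ∃ λ v → c v ≡ i)
           (c-connects : ∀ u v → (c u ≡ c v) ⇔ Path G (∁ A) u v) where

    evenExtension : ∀ H → (∀ i → edgeClass H i ≡ false) → EvenExtension H
    evenExtension H balanced = (H ∩ A) ⊕ J , even , onA
      where
      open ≡-Reasoning

      oddOnA : Fin n → Bool
      oddOnA = oddDegree G (lookup (H ∩ A))

      J : Subset m
      J = tabulate (T-join G (∁ A) c c-surjective c-connects oddOnA)

      even : ∀ v → oddDegree G (lookup ((H ∩ A) ⊕ J)) v ≡ false
      even v = begin
        oddDegree G (lookup ((H ∩ A) ⊕ J)) v
          ≡⟨ oddDegree-⊕ G (H ∩ A) J v ⟩
        oddOnA v xor oddDegree G (lookup J) v
          ≡⟨ cong (oddOnA v xor_) (oddDegree-cong G (lookup∘tabulate _) v) ⟩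
        oddOnA v xor oddDegree G (T-join G (∁ A) c c-surjective c-connects oddOnA) v
          ≡⟨ cong (oddOnA v xor_) (oddDegree-T-join G (∁ A) c c-surjective c-connects oddOnA balanced v) ⟩
        oddOnA v xor oddOnA v
          ≡⟨ xor-same (oddOnA v) ⟩
        false ∎

      onA : ∀ e → lookup A e ≡ true → lookup ((H ∩ A) ⊕ J) e ≡ lookup H e
      onA e e∈A = begin
        lookup ((H ∩ A) ⊕ J) e             ≡⟨ lookup-⊕ (H ∩ A) J e ⟩
        lookup (H ∩ A) e xor lookup J e    ≡⟨ cong₂ _xor_ H∩A-onA J-offA ⟩
        lookup H e xor false               ≡⟨ xor-identityʳ (lookup H e) ⟩
        lookup H e                         ∎
        where
        H∩A-onA : lookup (H ∩ A) e ≡ lookup H e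
        H∩A-onA = trans (lookup-zipWith _∧_ e H A) (trans (cong (lookup H e ∧_) e∈A) (∧-identityʳ _))
        J-offA : lookup J e ≡ false
        J-offA = trans (lookup∘tabulate _ e) (T-join-⊆ G (∁ A) c c-surjective c-connects oddOnA e
                                               (trans (lookup-map e not A) (cong not e∈A)))

    sameEdgeClass⇒ρ-CFIRelated :
      ∀ (S : Subset n) {μ} → IsCFISupport μ A → ∀ F F′ → (∀ i → edgeClass F i ≡ edgeClass F′ i) →
      Σ (HF (Atom m)) λ y → InOrbCFI G S μ y × ρ F μ ≈ ρ F′ y
    sameEdgeClass⇒ρ-CFIRelated S {μ} supp F F′ same =
      related (evenExtension (F ⊕ F′) (sameEdgeClass⇒⊕-balanced F F′ same))
      where
      related : EvenExtension (F ⊕ F′) → Σ (HF (Atom m)) λ y → InOrbCFI G S μ y × ρ F μ ≈ ρ F′ y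
      related (D , D-even , D-onA) =
        ρ D μ , (flipAtom D , evenFlip-isAutRestriction G S D D-even , ≈-refl (ρ D μ)) ,
        ρ-correctedOn-support supp F F′ D D-onA

    sameEdgeClass⇒ρ-inList :
      ∀ (S : Subset n) {μ} → IsCFISupport μ A → (ys : List (HF (Atom m))) →
      (∀ y → InOrbCFI G S μ y → y ∈≈ ys) → ∀ F F′ → (∀ i → edgeClass F i ≡ edgeClass F′ i) →
      Σ (Fin (length ys)) λ j → ρ F μ ≈ ρ F′ (List.lookup ys j)
    sameEdgeClass⇒ρ-inList S {μ} supp ys ys-complete F F′ same =
      inList (sameEdgeClass⇒ρ-CFIRelated S supp F F′ same)
      where
      inList : Σ (HF (Atom m)) (λ y → InOrbCFI G S μ y × ρ F μ ≈ ρ F′ y) →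
               Σ (Fin (length ys)) λ j → ρ F μ ≈ ρ F′ (List.lookup ys j)
      inList (y , y-inOrb , ρFμ≈ρF′y) with ∈≈⇒lookup ys (ys-complete y y-inOrb)
      ... | j , y≈yⱼ = j , ≈-trans _ _ _ ρFμ≈ρF′y (rename-≈ (flipAtom F′) y _ y≈yⱼ)

-- Counting

module _ {N a : ℕ} (C : Fin N → Fin a) where

  private
    pick : ∀ q → ∃ (λ j → C j ≡ q) → ∃ λ j → C j ≡ q
    pick q inhabited with any? (λ j → C j ≟ q)
    ... | yes witness = witness
    ... | no empty = ⊥-elim (empty inhabited)

    pick-resp : ∀ {q q′} w w′ → q ≡ q′ → proj₁ (pick q w) ≡ proj₁ (pick q′ w′)
    pick-resp {q} w _ refl with any? (λ j → C j ≟ q)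
    ... | yes _ = refl
    ... | no empty = ⊥-elim (empty w)

  representative : Fin N → Fin N
  representative i = proj₁ (pick (C i) (i , refl))

  representative-class : ∀ i → C (representative i) ≡ C i
  representative-class i = proj₂ (pick (C i) (i , refl))

  representative-resp : ∀ {i i′} → C i ≡ C i′ → representative i ≡ representative i′
  representative-resp {i} {i′} = pick-resp (i , refl) (i′ , refl)

module _ {X : Set} {a : ℕ} (xs ys : List (HF X)) (xs-distinct : Distinct≈ xs)
         (C : Fin (length xs) → Fin a) (translate : Fin (length xs) → HF X → HF X)
         (translate-resp : ∀ {i i′} → C i ≡ C i′ → translate i ≡ translate i′)
         (covered : ∀ i → Σ (Fin (length ys)) λ j → List.lookup xs i ≈ translate i (List.lookup ys j)) where

  length≤-byClasses : length xs ≤ a * length ys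
  length≤-byClasses = injective⇒≤ code-injective
    where
    code : Fin (length xs) → Fin (a * length ys)
    code i = combine (C i) (proj₁ (covered i))
    code-injective : ∀ {i i′} → code i ≡ code i′ → i ≡ i′
    code-injective {i} {i′} eq with combine-injective (C i) _ (C i′) _ eq
    ... | Ci≡Ci′ , jᵢ≡jᵢ′ = Distinct≈⇒lookup-injective xs-distinct i i′ (begin
      List.lookup xs i
        ≈⟨ proj₂ (covered i) ⟩
      translate i (List.lookup ys (proj₁ (covered i)))
        ≡⟨ cong₂ (λ t j → t (List.lookup ys j)) (translate-resp Ci≡Ci′) jᵢ≡jᵢ′ ⟩
      translate i′ (List.lookup ys (proj₁ (covered i′)))
        ≈⟨ proj₂ (covered i′) ⟨
      List.lookup xs i′ ∎)
      where open ≈-Reasoning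

classCode : ∀ {k} → (Fin k → Bool) → Fin (2 ^ k)
classCode f = funToFin (λ q → Inverse.from 2↔Bool (f q))

classCode-injective : ∀ {k} {f g : Fin k → Bool} → classCode f ≡ classCode g → ∀ q → f q ≡ g q
classCode-injective {k} {f} {g} eq q = begin
  f q                                ≡⟨ strictlyInverseˡ (f q) ⟨
  to (from (f q))                    ≡⟨ cong to (finToFun-funToFin (λ q′ → from (f q′)) q) ⟨
  to (finToFun (classCode f) q)      ≡⟨ cong (λ x → to (finToFun x q)) eq ⟩
  to (finToFun (classCode g) q)      ≡⟨ cong to (finToFun-funToFin (λ q′ → from (g q′)) q) ⟩
  to (from (g q))                    ≡⟨ strictlyInverseˡ (g q) ⟩
  g q                                ∎
  where
  open ≡-Reasoning
  open Inverse 2↔Bool using (to; from; strictlyInverseˡ)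

n≤n*n : ∀ n → n ≤ n * n
n≤n*n zero = z≤n
n≤n*n (suc n) = m≤m*n (suc n) (suc n)

lemma3p10 : ∀ {n m} (G : Graph n m) → Connected G →
    (S : Subset n) (μ : HF (Atom m)) (A : Subset m) → IsMinCFISupport μ A →
    (k : ℕ) → NumComponents G (∁ A) k →
    (oE oG : ℕ) → HasCard (InOrbE μ) oE → HasCard (InOrbCFI G S μ) oG →
    oE ≤ 2 ^ (k * k) * oG
lemma3p10 G _ S μ A (A-supp , _) k (c , c-surjective , c-connects) oE oG
  (xs , refl , xs-distinct , xs-inOrbE , _) (ys , refl , _ , _ , ys-complete) =
  ≤-trans (length≤-byClasses xs ys xs-distinct C translate translate-resp covered)
          (*-monoˡ-≤ (length ys) (^-monoʳ-≤ 2 (n≤n*n k)))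
  where
  flips : Fin (length xs) → Subset _
  flips i = proj₁ (All.lookup xs-inOrbE (∈-lookup i))
  C : Fin (length xs) → Fin (2 ^ k)
  C i = classCode (edgeClass G A c (flips i))
  translate : Fin (length xs) → HF (Atom _) → HF (Atom _)
  translate i = ρ (flips (representative C i))
  translate-resp : ∀ {i i′} → C i ≡ C i′ → translate i ≡ translate i′
  translate-resp Ci≡Ci′ = cong (λ j → ρ (flips j)) (representative-resp C Ci≡Ci′)
  covered : ∀ i → Σ (Fin (length ys)) λ j → List.lookup xs i ≈ translate i (List.lookup ys j)
  covered i = map₂ (≈-trans _ _ _ (proj₂ (All.lookup xs-inOrbE (∈-lookup i))))
    (sameEdgeClass⇒ρ-inList G A c c-surjective c-connects S A-supp ys ys-complete
       (flips i) (flips (representative C i)) (classCode-injective (sym (representative-class C i))))
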